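{- Let $(u_n)_{n\in\mathbb{N}}$ be the increasing sequence with $\{u_n:n\in\mathbb{N}\}=\{m\in\mathbb{N}: q_m=1\}$ and let $(m_n)_{n\in\mathbb{N}}$ be the Moser--de Bruijn sequence. Then $u_n=m_n+1$ for all $n\in\mathbb{N}$.
   Context: The Baum--Sweet sequence $(b_n)$ is defined by $b_0=1$ and, for $n\ge1$, $b_n=0$ if the binary expansion of $n$ contains a maximal block of $0$'s of odd length, $b_n=1$ otherwise. Let $D=\sum_{n\ge0}b''_nX^n\in\mathbb{F}_2[[X]]$ with $b''_0=0$, $b''_n=b_{n-1}$ ($n\ge1$), and let $Q=\sum q_nX^n$ be its composition inverse in $\mathbb{F}_2[[X]]$ (the unique series with $D(Q(X))=Q(D(X))=X$). The Moser--de Bruijn sequence $(m_n)_{n\in\mathbb{N}}$ is the increasing sequence of all natural numbers (including $0$) that are sums of distinct powers of $4$. -}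

module Defs where

open import Data.Bool using (Bool; true; false; _∧_; _xor_; not; if_then_else_)
open import Data.Nat using (ℕ; zero; suc; _+_; _∸_; _^_; _<_; _≡ᵇ_)
open import Data.Nat.DivMod using (_/_; _%_)
open import Data.List using (List; []; _∷_; map)
open import Data.Nat.ListAction using (sum)
open import Data.List.Relation.Unary.Unique.Propositional using (Unique)
open import Data.Product using (Σ; _×_; ∃)
open import Relation.Binary.PropositionalEquality using (_≡_)

-- Binary expansion (least significant bit first, no leading zeros).
-- The fuel argument k only needs to be ≥ the number of bits; fuel n suffices.

bitsFuel : ℕ → ℕ → List Bool
bitsFuel zero    _ = []
bitsFuel (suc k) zero = []
bitsFuel (suc k) n@(suc _) = (n % 2 ≡ᵇ 1) ∷ bitsFuel k (n / 2)

bits : ℕ → List Bool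
bits n = bitsFuel n n

-- noOddZeroBlock p l : p = parity (odd?) of the zero block read so far;
-- returns true iff every maximal block of 0s (false) in l has even length.
noOddZeroBlock : Bool → List Bool → Bool
noOddZeroBlock p []           = not p
noOddZeroBlock p (true ∷ xs)  = not p ∧ noOddZeroBlock false xs
noOddZeroBlock p (false ∷ xs) = noOddZeroBlock (not p) xs

baumSweet : ℕ → Bool
baumSweet zero          = true
baumSweet n@(suc _)     = noOddZeroBlock false (bits n)

-- Formal power series over F₂ (true = 1, false = 0, + = xor, * = ∧).

Series : Set
Series = ℕ → Bool

sumTo : (ℕ → Bool) → ℕ → Bool
sumTo f zero    = f zero
sumTo f (suc n) = sumTo f n xor f (suc n)

_⊛_ : Series → Series → Series
(f ⊛ g) n = sumTo (λ i → f i ∧ g (n ∸ i)) n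

one : Series
one n = n ≡ᵇ 0

X : Series
X n = n ≡ᵇ 1

pow : Series → ℕ → Series
pow g zero    = one
pow g (suc k) = g ⊛ pow g k

-- Composition f(g(X)); meaningful when g has zero constant term
-- (then [X^n] g^k = 0 for k > n, so the sum is finite).
_∘ₛ_ : Series → Series → Series
(f ∘ₛ g) n = sumTo (λ k → f k ∧ pow g k n) n

D : Series
D zero    = false
D (suc n) = baumSweet n

StrictlyIncreasing : (ℕ → ℕ) → Set
StrictlyIncreasing u = ∀ i j → i < j → u i < u j

SumOfDistinctPowersOf4 : ℕ → Set
SumOfDistinctPowersOf4 m = Σ (List ℕ) λ es → Unique es × (sum (map (4 ^_) es) ≡ m)

module Submission where

-- The series Q inverse to D = Σ b_{n-1} Xⁿ has support {m + 1 : m a sum of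
-- distinct powers of 4}; the theorem is the enumerated form of this fact.
--
-- 1. Finite F₂-sums Σ< and their algebra (linearity, Fubini, Kronecker delta,
--    cancellation of symmetric pairs).
-- 2. Series over F₂ form a commutative ring under ⊕ and the Cauchy product ⊛.
-- 3. Frobenius: f² has coefficient f k at 2k and 0 at odd indices, so f⁴ is
--    f spread out to the multiples of 4.
-- 4. Composition with a series g without constant term is a ring homomorphism
--    sending X to g.
-- 5. The Baum–Sweet recurrences b(2t+1) = b(t), b(4t) = b(t), b(4t+2) = 0 give
--    the algebraic equation D⁴ = X³(D + D²).
-- 6. Base-4 digits of sums of distinct powers of 4 are 0 or 1.
-- 7. Composing with Q (D ∘ Q = X) yields X⁴ = Q³(X + X²), hence
--    X⁴Q = (X + X²)Q⁴, i.e. q₁ = 1, q_{4t+1} = q_{4t+2} = q_{t+1} and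
--    q_{4t+3} = q_{4t+4} = 0: the digit recursion of step 6, shifted by one.
-- 8. Two strictly increasing sequences with the same image coincide, which
--    turns the support statement into u n ≡ mdb n + 1.

open import Defs
open import Data.Bool using (Bool; true; false; _∧_; _xor_)
open import Data.Bool.Properties
  using (xor-identityʳ; xor-same; ∧-comm; ∧-assoc; ∧-idem; ∧-zeroʳ; ∧-distribʳ-xor; xor-∧-commutativeRing)
open import Data.Empty using (⊥-elim)
open import Data.List using (List; []; _∷_; map)
open import Data.List.Relation.Unary.All using (All; []; _∷_)
open import Data.List.Relation.Unary.AllPairs using ([]; _∷_)
open import Data.List.Relation.Unary.Unique.Propositional using (Unique)
open import Data.List.Relation.Unary.Unique.Propositional.Properties using (map⁺)
open import Data.Maybe using (Maybe; just; nothing)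
open import Data.Nat using (ℕ; zero; suc; _+_; _*_; _^_; _∸_; _≤_; _<_; _≡ᵇ_; z≤n; s≤s)
open import Data.Nat.DivMod using (_/_; _%_; [m+kn]%n≡m%n; m<n⇒m%n≡m; m*n%n≡0; m*n/n≡m; +-distrib-/; m/n<m)
open import Data.Nat.Induction using (<-rec)
open import Data.Nat.ListAction using (sum)
open import Data.Nat.Properties
open import Data.Product using (∃; _×_; _,_; proj₁; proj₂)
open import Data.Unit using (tt)
open import Function using (_∘_)
open import Level using (0ℓ)
open import Function.Bundles using (_⇔_; mk⇔; Equivalence)
open import Relation.Binary.PropositionalEquality
open import Relation.Nullary using (¬_; yes; no)
open import Tactic.RingSolver using (solve-∀)
open import Tactic.RingSolver.Core.AlmostCommutativeRing using (AlmostCommutativeRing; fromCommutativeRing)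
import Data.Nat.Tactic.RingSolver as ℕ-Solver

open ≡-Reasoning
open Equivalence using (to; from)

𝔽₂ : AlmostCommutativeRing 0ℓ 0ℓ
𝔽₂ = fromCommutativeRing xor-∧-commutativeRing isZero
  where
  isZero : ∀ x → Maybe (false ≡ x)
  isZero false = just refl
  isZero true  = nothing

false≢true : false ≢ true
false≢true ()

≡ᵇ-true : ∀ {m n} → m ≡ n → (m ≡ᵇ n) ≡ true
≡ᵇ-true {m} {n} m≡n with m ≡ᵇ n | ≡⇒≡ᵇ m n m≡n
... | true | _ = refl

≡ᵇ-false : ∀ {m n} → m ≢ n → (m ≡ᵇ n) ≡ false
≡ᵇ-false {m} {n} m≢n with m ≡ᵇ n | ≡ᵇ⇒≡ m n
... | false | _ = refl
... | true  | sound = ⊥-elim (m≢n (sound tt))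

≡ᵇ-equiv : ∀ {m n m′ n′} → (m ≡ n → m′ ≡ n′) → (m′ ≡ n′ → m ≡ n) →
  (m ≡ᵇ n) ≡ (m′ ≡ᵇ n′)
≡ᵇ-equiv {m} {n} there back with m ≟ n
... | yes m≡n = trans (≡ᵇ-true m≡n) (sym (≡ᵇ-true (there m≡n)))
... | no  m≢n = trans (≡ᵇ-false m≢n) (sym (≡ᵇ-false (λ e → m≢n (back e))))

≡ᵇ-sym : ∀ m n → (m ≡ᵇ n) ≡ (n ≡ᵇ m)
≡ᵇ-sym m n = ≡ᵇ-equiv {m} {n} sym sym

-- 1. Finite sums over F₂

Σ< : ℕ → (ℕ → Bool) → Bool
Σ< zero    f = false
Σ< (suc N) f = Σ< N f xor f N

sumTo≡Σ< : ∀ f n → sumTo f n ≡ Σ< (suc n) f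
sumTo≡Σ< f zero    = refl
sumTo≡Σ< f (suc n) = cong (_xor f (suc n)) (sumTo≡Σ< f n)

Σ<-cong : ∀ N {f g} → (∀ i → i < N → f i ≡ g i) → Σ< N f ≡ Σ< N g
Σ<-cong zero    eq = refl
Σ<-cong (suc N) eq = cong₂ _xor_ (Σ<-cong N (λ i i<N → eq i (m<n⇒m<1+n i<N))) (eq N ≤-refl)

Σ<-congᶠ : ∀ N {f g} → (∀ i → f i ≡ g i) → Σ< N f ≡ Σ< N g
Σ<-congᶠ N eq = Σ<-cong N (λ i _ → eq i)

Σ<-vanish : ∀ N {f} → (∀ i → i < N → f i ≡ false) → Σ< N f ≡ false
Σ<-vanish zero    zeros = refl
Σ<-vanish (suc N) zeros =
  cong₂ _xor_ (Σ<-vanish N (λ i i<N → zeros i (m<n⇒m<1+n i<N))) (zeros N ≤-refl)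

xor-interchange : ∀ a b c d → (a xor b) xor (c xor d) ≡ (a xor c) xor (b xor d)
xor-interchange = solve-∀ 𝔽₂

Σ<-xor : ∀ N (f g : ℕ → Bool) → Σ< N (λ i → f i xor g i) ≡ Σ< N f xor Σ< N g
Σ<-xor zero    f g = refl
Σ<-xor (suc N) f g =
  trans (cong (_xor (f N xor g N)) (Σ<-xor N f g)) (xor-interchange (Σ< N f) (Σ< N g) (f N) (g N))

-- Every map φ : Bool → Bool with φ false ≡ false is F₂-linear, hence
-- commutes with finite sums; this covers all "multiply by a constant" steps.
Σ<-map : ∀ (φ : Bool → Bool) → φ false ≡ false → ∀ N f → φ (Σ< N f) ≡ Σ< N (λ i → φ (f i))
Σ<-map φ φ0 zero    f = φ0
Σ<-map φ φ0 (suc N) f = trans (linear (Σ< N f) (f N)) (cong (_xor φ (f N)) (Σ<-map φ φ0 N f))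
  where
  linear : ∀ a b → φ (a xor b) ≡ φ a xor φ b
  linear false b     = cong (_xor φ b) (sym φ0)
  linear true  false = trans (sym (xor-identityʳ (φ true))) (cong (φ true xor_) (sym φ0))
  linear true  true  = trans φ0 (sym (xor-same (φ true)))

Σ<²-map : ∀ (φ : Bool → Bool) → φ false ≡ false → ∀ N (f : ℕ → ℕ → Bool) →
  φ (Σ< N (λ i → Σ< N (f i))) ≡ Σ< N (λ i → Σ< N (λ j → φ (f i j)))
Σ<²-map φ φ0 N f = trans (Σ<-map φ φ0 N _) (Σ<-congᶠ N (λ i → Σ<-map φ φ0 N (f i)))

Σ<-∧-Σ< : ∀ N M (f g : ℕ → Bool) → Σ< N f ∧ Σ< M g ≡ Σ< N (λ i → Σ< M (λ j → f i ∧ g j))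
Σ<-∧-Σ< N M f g =
  trans (Σ<-map (_∧ Σ< M g) refl N f) (Σ<-congᶠ N (λ i → Σ<-map (f i ∧_) (∧-zeroʳ (f i)) M g))

Σ<-extend : ∀ N M {f} → N ≤ M → (∀ i → N ≤ i → i < M → f i ≡ false) → Σ< M f ≡ Σ< N f
Σ<-extend N zero    z≤n    zeros = refl
Σ<-extend N (suc M) N≤1+M zeros with N ≟ suc M
... | yes refl = refl
... | no  N≢1+M = trans (cong₂ _xor_ (Σ<-extend N M N≤M (λ i N≤i i<M → zeros i N≤i (m<n⇒m<1+n i<M)))
                                     (zeros M N≤M ≤-refl))
                        (xor-identityʳ _)
  where N≤M = ≤-pred (≤∧≢⇒< N≤1+M N≢1+M)

Σ<-swap : ∀ N M (f : ℕ → ℕ → Bool) → Σ< N (λ i → Σ< M (f i)) ≡ Σ< M (λ j → Σ< N (λ i → f i j))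
Σ<-swap zero    M f = sym (Σ<-vanish M (λ _ _ → refl))
Σ<-swap (suc N) M f =
  trans (cong (_xor Σ< M (f N)) (Σ<-swap N M f)) (sym (Σ<-xor M (λ j → Σ< N (λ i → f i j)) (f N)))

Σ<-rotate : ∀ N (f : ℕ → ℕ → ℕ → Bool) →
  Σ< N (λ a → Σ< N (λ b → Σ< N (f a b))) ≡ Σ< N (λ b → Σ< N (λ c → Σ< N (λ a → f a b c)))
Σ<-rotate N f = trans (Σ<-swap N N (λ a b → Σ< N (f a b))) (Σ<-congᶠ N (λ b → Σ<-swap N N (λ a → f a b)))

Σ<-swap-pairs : ∀ N (f : ℕ → ℕ → ℕ → ℕ → Bool) →
  Σ< N (λ a → Σ< N (λ b → Σ< N (λ i → Σ< N (f a b i)))) ≡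
  Σ< N (λ i → Σ< N (λ j → Σ< N (λ a → Σ< N (λ b → f a b i j))))
Σ<-swap-pairs N f = begin
  Σ< N (λ a → Σ< N (λ b → Σ< N (λ i → Σ< N (f a b i))))
    ≡⟨ Σ<-congᶠ N (λ a → Σ<-swap N N (λ b i → Σ< N (f a b i))) ⟩
  Σ< N (λ a → Σ< N (λ i → Σ< N (λ b → Σ< N (f a b i))))
    ≡⟨ Σ<-swap N N _ ⟩
  Σ< N (λ i → Σ< N (λ a → Σ< N (λ b → Σ< N (f a b i))))
    ≡⟨ Σ<-congᶠ N (λ i → Σ<-congᶠ N (λ a → Σ<-swap N N (λ b j → f a b i j))) ⟩
  Σ< N (λ i → Σ< N (λ a → Σ< N (λ j → Σ< N (λ b → f a b i j))))
    ≡⟨ Σ<-congᶠ N (λ i → Σ<-swap N N _) ⟩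
  Σ< N (λ i → Σ< N (λ j → Σ< N (λ a → Σ< N (λ b → f a b i j))))  ∎

Σ<-delta : ∀ N a (g : ℕ → Bool) → (N ≤ a → g a ≡ false) → Σ< N (λ i → (i ≡ᵇ a) ∧ g i) ≡ g a
Σ<-delta N a g outside with a <? N
... | no  a≮N = trans (Σ<-vanish N (λ i i<N → cong (_∧ g i) (≡ᵇ-false {i} {a} (λ { refl → a≮N i<N }))))
                      (sym (outside (≮⇒≥ a≮N)))
... | yes a<N = inside N a<N
  where
  inside : ∀ N → a < N → Σ< N (λ i → (i ≡ᵇ a) ∧ g i) ≡ g a
  inside (suc N) a<1+N with a ≟ N
  ... | yes refl = cong₂ _xor_ (Σ<-vanish N (λ i i<a → cong (_∧ g i) (≡ᵇ-false (<⇒≢ i<a))))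
                               (cong (_∧ g a) (≡ᵇ-true {a} refl))
  ... | no  a≢N  = trans (cong₂ _xor_ (inside N (≤∧≢⇒< (≤-pred a<1+N) a≢N))
                                      (cong (_∧ g N) (≡ᵇ-false (λ N≡a → a≢N (sym N≡a)))))
                         (xor-identityʳ (g a))

-- In a symmetric double sum the off-diagonal terms cancel in pairs.
Σ<-diagonal : ∀ N (f : ℕ → ℕ → Bool) → (∀ i j → f i j ≡ f j i) →
  Σ< N (λ i → Σ< N (f i)) ≡ Σ< N (λ i → f i i)
Σ<-diagonal zero    f symm = refl
Σ<-diagonal (suc N) f symm = begin
  Σ< N (λ i → Σ< N (f i) xor f i N) xor (Σ< N (f N) xor f N N)
    ≡⟨ cong (_xor (Σ< N (f N) xor f N N)) (Σ<-xor N (λ i → Σ< N (f i)) (λ i → f i N)) ⟩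
  (Σ< N (λ i → Σ< N (f i)) xor Σ< N (λ i → f i N)) xor (Σ< N (f N) xor f N N)
    ≡⟨ cong (λ c → (Σ< N (λ i → Σ< N (f i)) xor c) xor (Σ< N (f N) xor f N N)) (Σ<-congᶠ N (λ i → symm i N)) ⟩
  (Σ< N (λ i → Σ< N (f i)) xor Σ< N (f N)) xor (Σ< N (f N) xor f N N)
    ≡⟨ cancel (Σ< N (λ i → Σ< N (f i))) (Σ< N (f N)) (f N N) ⟩
  Σ< N (λ i → Σ< N (f i)) xor f N N
    ≡⟨ cong (_xor f N N) (Σ<-diagonal N f symm) ⟩
  Σ< N (λ i → f i i) xor f N N  ∎
  where
  cancel : ∀ a b c → (a xor b) xor (b xor c) ≡ a xor c
  cancel a false c = cong (_xor c) (xor-identityʳ a)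
  cancel false true false = refl
  cancel false true true  = refl
  cancel true  true false = refl
  cancel true  true true  = refl

sumTo-congᶠ : ∀ {f g} n → (∀ i → f i ≡ g i) → sumTo f n ≡ sumTo g n
sumTo-congᶠ {f} {g} n eq = trans (sumTo≡Σ< f n) (trans (Σ<-congᶠ (suc n) eq) (sym (sumTo≡Σ< g n)))

sumTo-xor : ∀ (f g : ℕ → Bool) n → sumTo (λ i → f i xor g i) n ≡ sumTo f n xor sumTo g n
sumTo-xor f g n =
  trans (sumTo≡Σ< _ n) (trans (Σ<-xor (suc n) f g) (sym (cong₂ _xor_ (sumTo≡Σ< f n) (sumTo≡Σ< g n))))

-- 2. The ring of series over F₂

infix 4 _≈_
infixl 6 _⊕_

_≈_ : Series → Series → Set
f ≈ g = ∀ n → f n ≡ g n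

_⊕_ : Series → Series → Series
(f ⊕ g) n = f n xor g n

⊛-double-sum : ∀ f g n N → n < N →
  (f ⊛ g) n ≡ Σ< N (λ i → Σ< N (λ j → (i + j ≡ᵇ n) ∧ (f i ∧ g j)))
⊛-double-sum f g n N n<N = sym (begin
  Σ< N row                            ≡⟨ Σ<-extend (suc n) N n<N (λ i n<i _ → row-beyond i n<i) ⟩
  Σ< (suc n) row                      ≡⟨ Σ<-cong (suc n) (λ i i<1+n → row-within i (≤-pred i<1+n)) ⟩
  Σ< (suc n) (λ i → f i ∧ g (n ∸ i))  ≡⟨ sym (sumTo≡Σ< _ n) ⟩
  (f ⊛ g) n                           ∎)
  where
  row : ℕ → Bool
  row i = Σ< N (λ j → (i + j ≡ᵇ n) ∧ (f i ∧ g j))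
  row-within : ∀ i → i ≤ n → row i ≡ f i ∧ g (n ∸ i)
  row-within i i≤n =
    trans (Σ<-congᶠ N (λ j → cong (_∧ (f i ∧ g j)) (≡ᵇ-equiv {i + j} {n} {j} {n ∸ i}
                       (λ e → trans (sym (m+n∸m≡n i j)) (cong (_∸ i) e))
                       (λ e → trans (cong (i +_) e) (m+[n∸m]≡n i≤n)))))
          (Σ<-delta N (n ∸ i) (λ j → f i ∧ g j)
                    (λ N≤n∸i → ⊥-elim (<⇒≱ (≤-<-trans (m∸n≤m n i) n<N) N≤n∸i)))
  row-beyond : ∀ i → n < i → row i ≡ false
  row-beyond i n<i = Σ<-vanish N (λ j _ → cong (_∧ (f i ∧ g j))
    (≡ᵇ-false {i + j} {n} (λ e → <⇒≱ n<i (subst (i ≤_) e (m≤m+n i j)))))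

⊛-cong : ∀ {f f′ g g′} → f ≈ f′ → g ≈ g′ → f ⊛ g ≈ f′ ⊛ g′
⊛-cong f≈f′ g≈g′ n = sumTo-congᶠ n (λ i → cong₂ _∧_ (f≈f′ i) (g≈g′ (n ∸ i)))

⊛-congˡ : ∀ {f f′} g → f ≈ f′ → f ⊛ g ≈ f′ ⊛ g
⊛-congˡ g f≈f′ = ⊛-cong {g = g} f≈f′ (λ _ → refl)

⊛-congʳ : ∀ f {g g′} → g ≈ g′ → f ⊛ g ≈ f ⊛ g′
⊛-congʳ f g≈g′ = ⊛-cong {f = f} (λ _ → refl) g≈g′

⊛-comm : ∀ f g → f ⊛ g ≈ g ⊛ f
⊛-comm f g n = begin
  (f ⊛ g) n                                             ≡⟨ ⊛-double-sum f g n N ≤-refl ⟩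
  Σ< N (λ i → Σ< N (λ j → (i + j ≡ᵇ n) ∧ (f i ∧ g j)))  ≡⟨ Σ<-swap N N _ ⟩
  Σ< N (λ j → Σ< N (λ i → (i + j ≡ᵇ n) ∧ (f i ∧ g j)))  ≡⟨ Σ<-congᶠ N (λ j → Σ<-congᶠ N (λ i →
                                                             cong₂ _∧_ (cong (_≡ᵇ n) (+-comm i j)) (∧-comm (f i) (g j)))) ⟩
  Σ< N (λ j → Σ< N (λ i → (j + i ≡ᵇ n) ∧ (g j ∧ f i)))  ≡⟨ sym (⊛-double-sum g f n N ≤-refl) ⟩
  (g ⊛ f) n                                             ∎
  where N = suc n

⊛-distribʳ : ∀ f g h → (g ⊕ h) ⊛ f ≈ (g ⊛ f) ⊕ (h ⊛ f)
⊛-distribʳ f g h n =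
  trans (sumTo-congᶠ n (λ i → ∧-distribʳ-xor (f (n ∸ i)) (g i) (h i))) (sumTo-xor _ _ n)

⊛-identityʳ : ∀ f → f ⊛ one ≈ f
⊛-identityʳ f n = begin
  (f ⊛ one) n                               ≡⟨ sumTo≡Σ< _ n ⟩
  Σ< (suc n) (λ i → f i ∧ (n ∸ i ≡ᵇ 0))     ≡⟨ Σ<-cong (suc n) (λ i i<1+n → delta i (≤-pred i<1+n)) ⟩
  Σ< (suc n) (λ i → (i ≡ᵇ n) ∧ f i)         ≡⟨ Σ<-delta (suc n) n f (λ 1+n≤n → ⊥-elim (<-irrefl refl 1+n≤n)) ⟩
  f n                                       ∎
  where
  delta : ∀ i → i ≤ n → f i ∧ (n ∸ i ≡ᵇ 0) ≡ (i ≡ᵇ n) ∧ f i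
  delta i i≤n = trans (∧-comm (f i) _) (cong (_∧ f i) (≡ᵇ-equiv {n ∸ i} {0}
    (λ e → ≤-antisym i≤n (m∸n≡0⇒m≤n e)) (λ { refl → n∸n≡0 i })))

⊛-identityˡ : ∀ f → one ⊛ f ≈ f
⊛-identityˡ f n = trans (⊛-comm one f n) (⊛-identityʳ f n)

triple : ℕ → Series → Series → Series → ℕ → Bool
triple N f g h n = Σ< N (λ i → Σ< N (λ j → Σ< N (λ c → (i + j + c ≡ᵇ n) ∧ (f i ∧ (g j ∧ h c)))))

⊛-triple : ∀ f g h n → ((f ⊛ g) ⊛ h) n ≡ triple (suc n) f g h n
⊛-triple f g h n = begin
  ((f ⊛ g) ⊛ h) n
    ≡⟨ ⊛-double-sum (f ⊛ g) h n N ≤-refl ⟩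
  Σ< N (λ a → Σ< N (λ c → (a + c ≡ᵇ n) ∧ ((f ⊛ g) a ∧ h c)))
    ≡⟨ Σ<-cong N (λ a a<N → Σ<-congᶠ N (λ c → expand a c a<N)) ⟩
  Σ< N (λ a → Σ< N (λ c → Σ< N (λ i → Σ< N (λ j → E i j a c))))
    ≡⟨ Σ<-swap-pairs N (λ a c i j → E i j a c) ⟩
  Σ< N (λ i → Σ< N (λ j → Σ< N (λ a → Σ< N (λ c → E i j a c))))
    ≡⟨ Σ<-congᶠ N (λ i → Σ<-congᶠ N (λ j → Σ<-swap N N (E i j))) ⟩
  Σ< N (λ i → Σ< N (λ j → Σ< N (λ c → Σ< N (λ a → E i j a c))))
    ≡⟨ Σ<-congᶠ N (λ i → Σ<-congᶠ N (λ j → Σ<-congᶠ N (λ c →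
         Σ<-delta N (i + j) (λ a → (a + c ≡ᵇ n) ∧ W i j c) (beyond i j c)))) ⟩
  triple N f g h n  ∎
  where
  N = suc n
  W : ℕ → ℕ → ℕ → Bool
  W i j c = f i ∧ (g j ∧ h c)
  E : ℕ → ℕ → ℕ → ℕ → Bool
  E i j a c = (a ≡ᵇ i + j) ∧ ((a + c ≡ᵇ n) ∧ W i j c)
  rearrange : ∀ p q x y z → p ∧ ((q ∧ (x ∧ y)) ∧ z) ≡ q ∧ (p ∧ (x ∧ (y ∧ z)))
  rearrange = solve-∀ 𝔽₂
  expand : ∀ a c → a < N → (a + c ≡ᵇ n) ∧ ((f ⊛ g) a ∧ h c) ≡ Σ< N (λ i → Σ< N (λ j → E i j a c))
  expand a c a<N = begin
    (a + c ≡ᵇ n) ∧ ((f ⊛ g) a ∧ h c)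
      ≡⟨ cong (λ s → (a + c ≡ᵇ n) ∧ (s ∧ h c)) (⊛-double-sum f g a N a<N) ⟩
    (a + c ≡ᵇ n) ∧ (Σ< N (λ i → Σ< N (λ j → (i + j ≡ᵇ a) ∧ (f i ∧ g j))) ∧ h c)
      ≡⟨ Σ<²-map (λ s → (a + c ≡ᵇ n) ∧ (s ∧ h c)) (∧-zeroʳ (a + c ≡ᵇ n)) N _ ⟩
    Σ< N (λ i → Σ< N (λ j → (a + c ≡ᵇ n) ∧ (((i + j ≡ᵇ a) ∧ (f i ∧ g j)) ∧ h c)))
      ≡⟨ Σ<-congᶠ N (λ i → Σ<-congᶠ N (λ j → trans (rearrange (a + c ≡ᵇ n) (i + j ≡ᵇ a) (f i) (g j) (h c))
                                                   (cong (_∧ ((a + c ≡ᵇ n) ∧ W i j c)) (≡ᵇ-sym (i + j) a)))) ⟩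
    Σ< N (λ i → Σ< N (λ j → E i j a c))  ∎
  beyond : ∀ i j c → N ≤ i + j → (i + j + c ≡ᵇ n) ∧ W i j c ≡ false
  beyond i j c N≤i+j = cong (_∧ W i j c) (≡ᵇ-false {i + j + c} {n}
    (λ e → <⇒≱ (n<1+n n) (subst (N ≤_) e (≤-trans N≤i+j (m≤m+n (i + j) c)))))

triple-rotate : ∀ N f g h n → triple N f g h n ≡ triple N g h f n
triple-rotate N f g h n = trans (Σ<-rotate N _) (Σ<-congᶠ N (λ j → Σ<-congᶠ N (λ c → Σ<-congᶠ N (λ i →
  cong₂ _∧_ (cong (_≡ᵇ n) (trans (+-assoc i j c) (+-comm i (j + c)))) (rotate (f i) (g j) (h c))))))
  where
  rotate : ∀ x y z → x ∧ (y ∧ z) ≡ y ∧ (z ∧ x)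
  rotate = solve-∀ 𝔽₂

⊛-assoc : ∀ f g h → (f ⊛ g) ⊛ h ≈ f ⊛ (g ⊛ h)
⊛-assoc f g h n = begin
  ((f ⊛ g) ⊛ h) n          ≡⟨ ⊛-triple f g h n ⟩
  triple (suc n) f g h n   ≡⟨ triple-rotate (suc n) f g h n ⟩
  triple (suc n) g h f n   ≡⟨ sym (⊛-triple g h f n) ⟩
  ((g ⊛ h) ⊛ f) n          ≡⟨ ⊛-comm (g ⊛ h) f n ⟩
  (f ⊛ (g ⊛ h)) n          ∎

-- 3. Frobenius: squaring spreads the coefficients to the even indices

-- In characteristic 2 the cross terms f_i f_j + f_j f_i of a square cancel.
square-coeff : ∀ f n → (f ⊛ f) n ≡ Σ< (suc n) (λ i → (i * 2 ≡ᵇ n) ∧ f i)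
square-coeff f n = begin
  (f ⊛ f) n
    ≡⟨ ⊛-double-sum f f n N ≤-refl ⟩
  Σ< N (λ i → Σ< N (λ j → (i + j ≡ᵇ n) ∧ (f i ∧ f j)))
    ≡⟨ Σ<-diagonal N _ (λ i j → cong₂ _∧_ (cong (_≡ᵇ n) (+-comm i j)) (∧-comm (f i) (f j))) ⟩
  Σ< N (λ i → (i + i ≡ᵇ n) ∧ (f i ∧ f i))
    ≡⟨ Σ<-congᶠ N (λ i → cong₂ _∧_ (cong (_≡ᵇ n) (double i)) (∧-idem (f i))) ⟩
  Σ< N (λ i → (i * 2 ≡ᵇ n) ∧ f i)  ∎
  where
  N = suc n
  double : ∀ i → i + i ≡ i * 2
  double = ℕ-Solver.solve-∀

square-even : ∀ f k → (f ⊛ f) (k * 2) ≡ f k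
square-even f k = begin
  (f ⊛ f) (k * 2)                                ≡⟨ square-coeff f (k * 2) ⟩
  Σ< (suc (k * 2)) (λ i → (i * 2 ≡ᵇ k * 2) ∧ f i) ≡⟨ Σ<-congᶠ (suc (k * 2)) (λ i → cong (_∧ f i)
                                                      (≡ᵇ-equiv {i * 2} {k * 2} (*-cancelʳ-≡ i k 2) (cong (_* 2)))) ⟩
  Σ< (suc (k * 2)) (λ i → (i ≡ᵇ k) ∧ f i)         ≡⟨ Σ<-delta (suc (k * 2)) k f
                                                      (λ 1+2k≤k → ⊥-elim (<⇒≱ (s≤s (m≤m*n k 2)) 1+2k≤k)) ⟩
  f k                                            ∎

square-odd : ∀ f k → (f ⊛ f) (suc (k * 2)) ≡ false
square-odd f k = trans (square-coeff f (suc (k * 2))) (Σ<-vanish (suc (suc (k * 2))) (λ i _ →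
  cong (_∧ f i) (≡ᵇ-false {i * 2} {suc (k * 2)} (λ e → parity (trans (sym (m*n%n≡0 i 2))
                                                                  (trans (cong (_% 2) e) ([m+kn]%n≡m%n 1 k 2)))))))
  where
  parity : 0 ≢ 1
  parity ()

×4≡×2×2 : ∀ t → t * 4 ≡ t * 2 * 2
×4≡×2×2 t = sym (*-assoc t 2 2)

pow-2 : ∀ f → pow f 2 ≈ f ⊛ f
pow-2 f = ⊛-congʳ f (⊛-identityʳ f)

pow-4 : ∀ f → pow f 4 ≈ (f ⊛ f) ⊛ (f ⊛ f)
pow-4 f n = trans (⊛-congʳ f (⊛-congʳ f (pow-2 f)) n) (sym (⊛-assoc f f (f ⊛ f) n))

pow-4-multiple : ∀ f t → pow f 4 (t * 4) ≡ f t
pow-4-multiple f t = begin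
  pow f 4 (t * 4)                   ≡⟨ pow-4 f (t * 4) ⟩
  ((f ⊛ f) ⊛ (f ⊛ f)) (t * 4)       ≡⟨ cong ((f ⊛ f) ⊛ (f ⊛ f)) (×4≡×2×2 t) ⟩
  ((f ⊛ f) ⊛ (f ⊛ f)) (t * 2 * 2)   ≡⟨ square-even (f ⊛ f) (t * 2) ⟩
  (f ⊛ f) (t * 2)                   ≡⟨ square-even f t ⟩
  f t                               ∎

pow-4-off : ∀ f r t → 0 < r → r < 4 → pow f 4 (r + t * 4) ≡ false
pow-4-off f r t 0<r r<4 =
  trans (pow-4 f (r + t * 4)) (trans (cong (λ m → F (r + m)) (×4≡×2×2 t)) (off r 0<r r<4))
  where
  F : Series
  F = (f ⊛ f) ⊛ (f ⊛ f)
  off : ∀ r → 0 < r → r < 4 → F (r + t * 2 * 2) ≡ false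
  off 1 _ _ = square-odd (f ⊛ f) (t * 2)
  off 2 _ _ = trans (square-even (f ⊛ f) (suc (t * 2))) (square-odd f t)
  off 3 _ _ = square-odd (f ⊛ f) (suc (t * 2))
  off (suc (suc (suc (suc r)))) _ (s≤s (s≤s (s≤s (s≤s ()))))

-- 4. Composition with a series without constant term

pow-cong : ∀ {f g} → f ≈ g → ∀ k → pow f k ≈ pow g k
pow-cong f≈g zero    = λ _ → refl
pow-cong f≈g (suc k) = ⊛-cong f≈g (pow-cong f≈g k)

pow-+ : ∀ g i j → pow g (i + j) ≈ pow g i ⊛ pow g j
pow-+ g zero    j n = sym (⊛-identityˡ (pow g j) n)
pow-+ g (suc i) j n = trans (⊛-congʳ g (pow-+ g i j) n) (sym (⊛-assoc g (pow g i) (pow g j) n))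

pow-vanish : ∀ g → g 0 ≡ false → ∀ k n → n < k → pow g k n ≡ false
pow-vanish g g₀ (suc k) n n<1+k = trans (sumTo≡Σ< _ n) (Σ<-vanish (suc n) term)
  where
  term : ∀ i → i < suc n → g i ∧ pow g k (n ∸ i) ≡ false
  term zero    _      = cong (_∧ pow g k n) g₀
  term (suc i) i<n = trans (cong (g (suc i) ∧_) (pow-vanish g g₀ k (n ∸ suc i)
                                 (<-≤-trans (∸-monoʳ-< (s≤s z≤n) (≤-pred i<n)) (≤-pred n<1+k))))
                           (∧-zeroʳ (g (suc i)))

∘ₛ-as-sum : ∀ f g → g 0 ≡ false → ∀ n N → n < N → (f ∘ₛ g) n ≡ Σ< N (λ k → f k ∧ pow g k n)
∘ₛ-as-sum f g g₀ n N n<N = trans (sumTo≡Σ< _ n) (sym (Σ<-extend (suc n) N n<N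
  (λ k n<k _ → trans (cong (f k ∧_) (pow-vanish g g₀ k n n<k)) (∧-zeroʳ (f k)))))

∘ₛ-cong : ∀ {f f′} g → f ≈ f′ → f ∘ₛ g ≈ f′ ∘ₛ g
∘ₛ-cong g f≈f′ n = sumTo-congᶠ n (λ k → cong (_∧ pow g k n) (f≈f′ k))

∘ₛ-⊕ : ∀ f h g → (f ⊕ h) ∘ₛ g ≈ (f ∘ₛ g) ⊕ (h ∘ₛ g)
∘ₛ-⊕ f h g n = trans (sumTo-congᶠ n (λ k → ∧-distribʳ-xor (pow g k n) (f k) (h k))) (sumTo-xor _ _ n)

∘ₛ-one : ∀ g → one ∘ₛ g ≈ one
∘ₛ-one g n = trans (sumTo≡Σ< _ n) (Σ<-delta (suc n) 0 (λ k → pow g k n) (λ ()))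

∘ₛ-X : ∀ g → g 0 ≡ false → X ∘ₛ g ≈ g
∘ₛ-X g g₀ n = begin
  (X ∘ₛ g) n                       ≡⟨ ∘ₛ-as-sum X g g₀ n N (m<n⇒m<1+n (n<1+n n)) ⟩
  Σ< N (λ k → (k ≡ᵇ 1) ∧ pow g k n) ≡⟨ Σ<-delta N 1 (λ k → pow g k n) (λ { (s≤s ()) }) ⟩
  (g ⊛ one) n                      ≡⟨ ⊛-identityʳ g n ⟩
  g n                              ∎
  where N = suc (suc n)

-- Both sides of (f h) ∘ g = (f ∘ g)(h ∘ g) expand to Σ_{i,j} f_i h_j g^{i+j}.
∘ₛ-⊛-expandˡ : ∀ f h g → g 0 ≡ false → ∀ n →
  ((f ⊛ h) ∘ₛ g) n ≡ Σ< (suc n) (λ i → Σ< (suc n) (λ j → (f i ∧ h j) ∧ pow g (i + j) n))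
∘ₛ-⊛-expandˡ f h g g₀ n = begin
  ((f ⊛ h) ∘ₛ g) n
    ≡⟨ ∘ₛ-as-sum (f ⊛ h) g g₀ n N ≤-refl ⟩
  Σ< N (λ k → (f ⊛ h) k ∧ G k)
    ≡⟨ Σ<-cong N (λ k k<N → trans (cong (_∧ G k) (⊛-double-sum f h k N k<N)) (Σ<²-map (_∧ G k) refl N _)) ⟩
  Σ< N (λ k → Σ< N (λ i → Σ< N (λ j → ((i + j ≡ᵇ k) ∧ (f i ∧ h j)) ∧ G k)))
    ≡⟨ Σ<-rotate N _ ⟩
  Σ< N (λ i → Σ< N (λ j → Σ< N (λ k → ((i + j ≡ᵇ k) ∧ (f i ∧ h j)) ∧ G k)))
    ≡⟨ Σ<-congᶠ N (λ i → Σ<-congᶠ N (λ j → trans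
         (Σ<-congᶠ N (λ k → trans (∧-assoc (i + j ≡ᵇ k) _ (G k))
                                  (cong (_∧ ((f i ∧ h j) ∧ G k)) (≡ᵇ-sym (i + j) k))))
         (Σ<-delta N (i + j) (λ k → (f i ∧ h j) ∧ G k) (λ N≤i+j →
            trans (cong ((f i ∧ h j) ∧_) (pow-vanish g g₀ (i + j) n N≤i+j)) (∧-zeroʳ _))))) ⟩
  Σ< N (λ i → Σ< N (λ j → (f i ∧ h j) ∧ G (i + j)))  ∎
  where
  N = suc n
  G : ℕ → Bool
  G k = pow g k n

∘ₛ-⊛-expandʳ : ∀ f h g → g 0 ≡ false → ∀ n →
  ((f ∘ₛ g) ⊛ (h ∘ₛ g)) n ≡ Σ< (suc n) (λ i → Σ< (suc n) (λ j → (f i ∧ h j) ∧ (pow g i ⊛ pow g j) n))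
∘ₛ-⊛-expandʳ f h g g₀ n = begin
  ((f ∘ₛ g) ⊛ (h ∘ₛ g)) n
    ≡⟨ ⊛-double-sum (f ∘ₛ g) (h ∘ₛ g) n N ≤-refl ⟩
  Σ< N (λ a → Σ< N (λ b → (a + b ≡ᵇ n) ∧ ((f ∘ₛ g) a ∧ (h ∘ₛ g) b)))
    ≡⟨ Σ<-cong N (λ a a<N → Σ<-cong N (λ b b<N → begin
         (a + b ≡ᵇ n) ∧ ((f ∘ₛ g) a ∧ (h ∘ₛ g) b)
           ≡⟨ cong₂ (λ x y → (a + b ≡ᵇ n) ∧ (x ∧ y))
                    (∘ₛ-as-sum f g g₀ a N a<N) (∘ₛ-as-sum h g g₀ b N b<N) ⟩
         (a + b ≡ᵇ n) ∧ (Σ< N (λ i → f i ∧ pow g i a) ∧ Σ< N (λ j → h j ∧ pow g j b))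
           ≡⟨ cong ((a + b ≡ᵇ n) ∧_) (Σ<-∧-Σ< N N _ _) ⟩
         (a + b ≡ᵇ n) ∧ Σ< N (λ i → Σ< N (λ j → (f i ∧ pow g i a) ∧ (h j ∧ pow g j b)))
           ≡⟨ Σ<²-map ((a + b ≡ᵇ n) ∧_) (∧-zeroʳ _) N _ ⟩
         Σ< N (λ i → Σ< N (λ j → E a b i j))  ∎)) ⟩
  Σ< N (λ a → Σ< N (λ b → Σ< N (λ i → Σ< N (λ j → E a b i j))))
    ≡⟨ Σ<-swap-pairs N E ⟩
  Σ< N (λ i → Σ< N (λ j → Σ< N (λ a → Σ< N (λ b → E a b i j))))
    ≡⟨ Σ<-congᶠ N (λ i → Σ<-congᶠ N (λ j → sym (begin
         (f i ∧ h j) ∧ (pow g i ⊛ pow g j) n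
           ≡⟨ cong ((f i ∧ h j) ∧_) (⊛-double-sum (pow g i) (pow g j) n N ≤-refl) ⟩
         (f i ∧ h j) ∧ Σ< N (λ a → Σ< N (λ b → (a + b ≡ᵇ n) ∧ (pow g i a ∧ pow g j b)))
           ≡⟨ Σ<²-map ((f i ∧ h j) ∧_) (∧-zeroʳ _) N _ ⟩
         Σ< N (λ a → Σ< N (λ b → (f i ∧ h j) ∧ ((a + b ≡ᵇ n) ∧ (pow g i a ∧ pow g j b))))
           ≡⟨ Σ<-congᶠ N (λ a → Σ<-congᶠ N (λ b → regroup (f i) (h j) (a + b ≡ᵇ n) (pow g i a) (pow g j b))) ⟩
         Σ< N (λ a → Σ< N (λ b → E a b i j))  ∎))) ⟩
  Σ< N (λ i → Σ< N (λ j → (f i ∧ h j) ∧ (pow g i ⊛ pow g j) n))  ∎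
  where
  N = suc n
  E : ℕ → ℕ → ℕ → ℕ → Bool
  E a b i j = (a + b ≡ᵇ n) ∧ ((f i ∧ pow g i a) ∧ (h j ∧ pow g j b))
  regroup : ∀ x y p u v → (x ∧ y) ∧ (p ∧ (u ∧ v)) ≡ p ∧ ((x ∧ u) ∧ (y ∧ v))
  regroup = solve-∀ 𝔽₂

∘ₛ-⊛ : ∀ g → g 0 ≡ false → ∀ f h → (f ⊛ h) ∘ₛ g ≈ (f ∘ₛ g) ⊛ (h ∘ₛ g)
∘ₛ-⊛ g g₀ f h n = begin
  ((f ⊛ h) ∘ₛ g) n                                                       ≡⟨ ∘ₛ-⊛-expandˡ f h g g₀ n ⟩
  Σ< N (λ i → Σ< N (λ j → (f i ∧ h j) ∧ pow g (i + j) n))                ≡⟨ Σ<-congᶠ N (λ i → Σ<-congᶠ N (λ j →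
                                                                              cong ((f i ∧ h j) ∧_) (pow-+ g i j n))) ⟩
  Σ< N (λ i → Σ< N (λ j → (f i ∧ h j) ∧ (pow g i ⊛ pow g j) n))          ≡⟨ sym (∘ₛ-⊛-expandʳ f h g g₀ n) ⟩
  ((f ∘ₛ g) ⊛ (h ∘ₛ g)) n                                                ∎
  where N = suc n

∘ₛ-pow : ∀ g → g 0 ≡ false → ∀ f k → pow f k ∘ₛ g ≈ pow (f ∘ₛ g) k
∘ₛ-pow g g₀ f zero    n = ∘ₛ-one g n
∘ₛ-pow g g₀ f (suc k) n = trans (∘ₛ-⊛ g g₀ f (pow f k) n) (⊛-congʳ (f ∘ₛ g) (∘ₛ-pow g g₀ f k) n)

∘ₛ-pow-X : ∀ g → g 0 ≡ false → ∀ k → pow X k ∘ₛ g ≈ pow g k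
∘ₛ-pow-X g g₀ k n = trans (∘ₛ-pow g g₀ X k n) (pow-cong (∘ₛ-X g g₀) k n)

-- 5. The algebraic equation of the Baum–Sweet series

bitsFuel-zero : ∀ k → bitsFuel k 0 ≡ []
bitsFuel-zero zero    = refl
bitsFuel-zero (suc k) = refl

bitsFuel-stable : ∀ k k′ n → n ≤ k → n ≤ k′ → bitsFuel k n ≡ bitsFuel k′ n
bitsFuel-stable k k′ zero _ _ = trans (bitsFuel-zero k) (sym (bitsFuel-zero k′))
bitsFuel-stable (suc k) (suc k′) (suc m) (s≤s m≤k) (s≤s m≤k′) =
  cong ((suc m % 2 ≡ᵇ 1) ∷_) (bitsFuel-stable k k′ (suc m / 2) (≤-trans half≤m m≤k) (≤-trans half≤m m≤k′))
  where
  half≤m : suc m / 2 ≤ m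
  half≤m = ≤-pred (m/n<m (suc m) 2 (s≤s (s≤s z≤n)))

bits-odd : ∀ n → bits (suc (n * 2)) ≡ true ∷ bits n
bits-odd n = cong₂ _∷_ (cong (_≡ᵇ 1) ([m+kn]%n≡m%n 1 n 2))
  (trans (cong (bitsFuel (n * 2)) half) (bitsFuel-stable (n * 2) n n (m≤m*n n 2) ≤-refl))
  where
  half : suc (n * 2) / 2 ≡ n
  half = trans (+-distrib-/ 1 (n * 2) (subst (λ r → 1 + r < 2) (sym (m*n%n≡0 n 2)) ≤-refl)) (m*n/n≡m n 2)

bits-even : ∀ m → bits (suc m * 2) ≡ false ∷ bits (suc m)
bits-even m = cong₂ _∷_ (cong (_≡ᵇ 1) (m*n%n≡0 (suc m) 2))
  (trans (cong (bitsFuel (suc (m * 2))) (m*n/n≡m (suc m) 2))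
         (bitsFuel-stable (suc (m * 2)) (suc m) (suc m) (s≤s (m≤m*n m 2)) ≤-refl))

-- Appending a 1, or the even block 00, does not change b; the block 10 makes it 0.
baumSweet-2n+1 : ∀ n → baumSweet (suc (n * 2)) ≡ baumSweet n
baumSweet-2n+1 zero    = refl
baumSweet-2n+1 (suc n) = cong (noOddZeroBlock false) (bits-odd (suc n))

baumSweet-4n : ∀ t → baumSweet (t * 4) ≡ baumSweet t
baumSweet-4n zero    = refl
baumSweet-4n (suc t) = begin
  noOddZeroBlock false (bits (suc t * 4))                 ≡⟨ cong (λ m → noOddZeroBlock false (bits m)) (×4≡×2×2 (suc t)) ⟩
  noOddZeroBlock false (bits (suc (suc (t * 2)) * 2))     ≡⟨ cong (noOddZeroBlock false) (bits-even (suc (t * 2))) ⟩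
  noOddZeroBlock false (false ∷ bits (suc t * 2))         ≡⟨ cong (λ bs → noOddZeroBlock false (false ∷ bs)) (bits-even t) ⟩
  noOddZeroBlock false (bits (suc t))                     ∎

baumSweet-4n+2 : ∀ t → baumSweet (2 + t * 4) ≡ false
baumSweet-4n+2 t = begin
  noOddZeroBlock false (bits (2 + t * 4))               ≡⟨ cong (λ m → noOddZeroBlock false (bits (2 + m))) (×4≡×2×2 t) ⟩
  noOddZeroBlock false (bits (suc (t * 2) * 2))         ≡⟨ cong (noOddZeroBlock false) (bits-even (t * 2)) ⟩
  noOddZeroBlock false (false ∷ bits (suc (t * 2)))     ≡⟨ cong (λ bs → noOddZeroBlock false (false ∷ bs)) (bits-odd t) ⟩
  false                                                 ∎

D-even : ∀ k → D (k * 2) ≡ D k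
D-even zero    = refl
D-even (suc k) = baumSweet-2n+1 k

D-4t+1 : ∀ t → D (1 + t * 4) ≡ D (suc t)
D-4t+1 = baumSweet-4n

D-4t+3 : ∀ t → D (3 + t * 4) ≡ false
D-4t+3 = baumSweet-4n+2

X-shift : ∀ F m → (X ⊛ F) (suc m) ≡ F m
X-shift F m = trans (sumTo≡Σ< _ (suc m)) (Σ<-delta (suc (suc m)) 1 (λ i → F (suc m ∸ i)) (λ { (s≤s ()) }))

Xᵏ-shift : ∀ k F j → (pow X k ⊛ F) (k + j) ≡ F j
Xᵏ-shift zero    F j = ⊛-identityˡ F j
Xᵏ-shift (suc k) F j = trans (⊛-assoc X (pow X k) F (suc (k + j))) (trans (X-shift (pow X k ⊛ F) (k + j)) (Xᵏ-shift k F j))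

Xᵏ-low : ∀ k F j → j < k → (pow X k ⊛ F) j ≡ false
Xᵏ-low (suc k) F zero    _         = ⊛-assoc X (pow X k) F 0
Xᵏ-low (suc k) F (suc j) (s≤s j<k) =
  trans (⊛-assoc X (pow X k) F (suc j)) (trans (X-shift (pow X k ⊛ F) j) (Xᵏ-low k F j j<k))

data Mod4 : ℕ → Set where
  rem0 : ∀ t → Mod4 (t * 4)
  rem1 : ∀ t → Mod4 (1 + t * 4)
  rem2 : ∀ t → Mod4 (2 + t * 4)
  rem3 : ∀ t → Mod4 (3 + t * 4)

mod4 : ∀ n → Mod4 n
mod4 zero = rem0 0
mod4 (suc n) with mod4 n
... | rem0 t = rem1 t
... | rem1 t = rem2 t
... | rem2 t = rem3 t
... | rem3 t = rem0 (suc t)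

-- At even indices D agrees with its square, by D(2k) = D(k) and Frobenius.
D-even-cancels : ∀ k → D (k * 2) xor pow D 2 (k * 2) ≡ false
D-even-cancels k = trans (cong (D (k * 2) xor_) (trans (pow-2 D (k * 2)) (trans (square-even D k) (sym (D-even k)))))
                         (xor-same (D (k * 2)))

pow-2-odd : ∀ f k → pow f 2 (suc (k * 2)) ≡ false
pow-2-odd f k = trans (pow-2 f (suc (k * 2))) (square-odd f k)

D-equation : pow D 4 ≈ pow X 3 ⊛ (D ⊕ pow D 2)
D-equation 0 = sym (Xᵏ-low 3 (D ⊕ pow D 2) 0 (s≤s z≤n))
D-equation 1 = trans (pow-4-off D 1 0 (s≤s z≤n) (s≤s (s≤s z≤n))) (sym (Xᵏ-low 3 (D ⊕ pow D 2) 1 (s≤s (s≤s z≤n))))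
D-equation 2 = trans (pow-4-off D 2 0 (s≤s z≤n) (s≤s (s≤s (s≤s z≤n))))
                     (sym (Xᵏ-low 3 (D ⊕ pow D 2) 2 (s≤s (s≤s (s≤s z≤n)))))
D-equation (suc (suc (suc j))) = trans (shifted j (mod4 j)) (sym (Xᵏ-shift 3 (D ⊕ pow D 2) j))
  where
  shifted : ∀ j → Mod4 j → pow D 4 (3 + j) ≡ D j xor pow D 2 j
  shifted _ (rem0 t) = begin
    pow D 4 (3 + t * 4)                    ≡⟨ pow-4-off D 3 t (s≤s z≤n) ≤-refl ⟩
    false                                  ≡⟨ sym (D-even-cancels (t * 2)) ⟩
    D (t * 2 * 2) xor pow D 2 (t * 2 * 2)  ≡⟨ cong (λ m → D m xor pow D 2 m) (sym (×4≡×2×2 t)) ⟩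
    D (t * 4) xor pow D 2 (t * 4)          ∎
  shifted _ (rem1 t) = begin
    pow D 4 (suc t * 4)                        ≡⟨ pow-4-multiple D (suc t) ⟩
    D (suc t)                                  ≡⟨ sym (xor-identityʳ (D (suc t))) ⟩
    D (suc t) xor false                        ≡⟨ cong₂ _xor_ (sym (D-4t+1 t)) (sym (pow-2-odd D (t * 2))) ⟩
    D (1 + t * 4) xor pow D 2 (1 + t * 2 * 2)  ≡⟨ cong (λ m → D (1 + t * 4) xor pow D 2 (1 + m)) (sym (×4≡×2×2 t)) ⟩
    D (1 + t * 4) xor pow D 2 (1 + t * 4)      ∎
  shifted _ (rem2 t) = begin
    pow D 4 (1 + suc t * 4)                        ≡⟨ pow-4-off D 1 (suc t) (s≤s z≤n) (s≤s (s≤s z≤n)) ⟩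
    false                                          ≡⟨ sym (D-even-cancels (suc (t * 2))) ⟩
    D (2 + t * 2 * 2) xor pow D 2 (2 + t * 2 * 2)  ≡⟨ cong (λ m → D (2 + m) xor pow D 2 (2 + m)) (sym (×4≡×2×2 t)) ⟩
    D (2 + t * 4) xor pow D 2 (2 + t * 4)          ∎
  shifted _ (rem3 t) = begin
    pow D 4 (2 + suc t * 4)                    ≡⟨ pow-4-off D 2 (suc t) (s≤s z≤n) (s≤s (s≤s (s≤s z≤n))) ⟩
    false                                      ≡⟨ cong₂ _xor_ (sym (D-4t+3 t)) (sym (pow-2-odd D (suc (t * 2)))) ⟩
    D (3 + t * 4) xor pow D 2 (3 + t * 2 * 2)  ≡⟨ cong (λ m → D (3 + t * 4) xor pow D 2 (3 + m)) (sym (×4≡×2×2 t)) ⟩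
    D (3 + t * 4) xor pow D 2 (3 + t * 4)      ∎

-- 6. Sums of distinct powers of 4, digit by digit

value4 : List ℕ → ℕ
value4 es = sum (map (4 ^_) es)

value4-shift : ∀ es → value4 (map suc es) ≡ value4 es * 4
value4-shift []       = refl
value4-shift (e ∷ es) = trans (cong (4 ^ suc e +_) (value4-shift es)) (distrib (4 ^ e) (value4 es))
  where
  distrib : ∀ a b → 4 * a + b * 4 ≡ (a + b) * 4
  distrib = ℕ-Solver.solve-∀

SP-zero : SumOfDistinctPowersOf4 0
SP-zero = [] , [] , refl

SP-×4 : ∀ t → SumOfDistinctPowersOf4 t → SumOfDistinctPowersOf4 (t * 4)
SP-×4 t (es , unique , value≡t) =
  map suc es , map⁺ suc-injective unique , trans (value4-shift es) (cong (_* 4) value≡t)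

SP-×4+1 : ∀ t → SumOfDistinctPowersOf4 t → SumOfDistinctPowersOf4 (1 + t * 4)
SP-×4+1 t (es , unique , value≡t) =
  0 ∷ map suc es , positive es ∷ map⁺ suc-injective unique , cong suc (trans (value4-shift es) (cong (_* 4) value≡t))
  where
  positive : ∀ es → All (λ e → 0 ≢ e) (map suc es)
  positive []       = []
  positive (e ∷ es) = (λ ()) ∷ positive es

-- Splitting off the exponent 0: the number of its occurrences is the last
-- base-4 digit, the remaining exponents (lowered by one) encode the rest.
zeros : List ℕ → ℕ
zeros []           = 0
zeros (zero ∷ es)  = suc (zeros es)
zeros (suc e ∷ es) = zeros es

lowered : List ℕ → List ℕ
lowered []           = []
lowered (zero ∷ es)  = lowered es
lowered (suc e ∷ es) = e ∷ lowered es

value4-split : ∀ es → value4 es ≡ zeros es + value4 (lowered es) * 4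
value4-split []           = refl
value4-split (zero ∷ es)  = cong suc (value4-split es)
value4-split (suc e ∷ es) = trans (cong (4 ^ suc e +_) (value4-split es)) (regroup (4 ^ e) (zeros es) (value4 (lowered es)))
  where
  regroup : ∀ a c b → 4 * a + (c + b * 4) ≡ c + (a + b) * 4
  regroup = ℕ-Solver.solve-∀

zeros-absent : ∀ es → All (λ e → 0 ≢ e) es → zeros es ≡ 0
zeros-absent []           _              = refl
zeros-absent (zero ∷ es)  (0≢0 ∷ _)      = ⊥-elim (0≢0 refl)
zeros-absent (suc e ∷ es) (_ ∷ absent)   = zeros-absent es absent

zeros-unique : ∀ es → Unique es → zeros es ≤ 1
zeros-unique []           _              = z≤n
zeros-unique (zero ∷ es)  (absent ∷ _)   = s≤s (≤-reflexive (zeros-absent es absent))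
zeros-unique (suc e ∷ es) (_ ∷ unique)   = zeros-unique es unique

lowered-unique : ∀ es → Unique es → Unique (lowered es)
lowered-unique []           _                = []
lowered-unique (zero ∷ es)  (_ ∷ unique)     = lowered-unique es unique
lowered-unique (suc e ∷ es) (fresh ∷ unique) = lowered-fresh es fresh ∷ lowered-unique es unique
  where
  lowered-fresh : ∀ es → All (λ x → suc e ≢ x) es → All (λ x → e ≢ x) (lowered es)
  lowered-fresh []           _            = []
  lowered-fresh (zero ∷ es)  (_ ∷ fresh)  = lowered-fresh es fresh
  lowered-fresh (suc x ∷ es) (e′≢x ∷ fresh) = (λ e≡x → e′≢x (cong suc e≡x)) ∷ lowered-fresh es fresh

base4-unique : ∀ c s r t → c < 4 → r < 4 → c + s * 4 ≡ r + t * 4 → c ≡ r × s ≡ t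
base4-unique c s r t c<4 r<4 eq = c≡r , *-cancelʳ-≡ s t 4 (+-cancelˡ-≡ c _ _ (trans eq (cong (_+ t * 4) (sym c≡r))))
  where
  c≡r : c ≡ r
  c≡r = begin
    c                 ≡⟨ sym (m<n⇒m%n≡m c<4) ⟩
    c % 4             ≡⟨ sym ([m+kn]%n≡m%n c s 4) ⟩
    (c + s * 4) % 4   ≡⟨ cong (_% 4) eq ⟩
    (r + t * 4) % 4   ≡⟨ [m+kn]%n≡m%n r t 4 ⟩
    r % 4             ≡⟨ m<n⇒m%n≡m r<4 ⟩
    r                 ∎

SP-digit : ∀ r t → r < 4 → SumOfDistinctPowersOf4 (r + t * 4) → r ≤ 1 × SumOfDistinctPowersOf4 t
SP-digit r t r<4 (es , unique , value≡) =
  subst (_≤ 1) (proj₁ digits) (zeros-unique es unique) , lowered es , lowered-unique es unique , proj₂ digits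
  where
  digits : zeros es ≡ r × value4 (lowered es) ≡ t
  digits = base4-unique (zeros es) (value4 (lowered es)) r t (s≤s (≤-trans (zeros-unique es unique) (s≤s z≤n))) r<4
                        (trans (sym (value4-split es)) value≡)

-- 7. The inverse series Q and its support

module Inverse (Q : Series) (Q₀ : Q 0 ≡ false) (D∘Q≈X : D ∘ₛ Q ≈ X) where

  -- Substituting Q into D⁴ = X³(D + D²) gives X⁴ = Q³(X + X²).
  X⁴≈Q³[X+X²] : pow X 4 ≈ pow Q 3 ⊛ (X ⊕ pow X 2)
  X⁴≈Q³[X+X²] n = begin
    pow X 4 n                                  ≡⟨ sym (pow-cong D∘Q≈X 4 n) ⟩
    pow (D ∘ₛ Q) 4 n                           ≡⟨ sym (∘ₛ-pow Q Q₀ D 4 n) ⟩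
    (pow D 4 ∘ₛ Q) n                           ≡⟨ ∘ₛ-cong Q D-equation n ⟩
    ((pow X 3 ⊛ (D ⊕ pow D 2)) ∘ₛ Q) n         ≡⟨ ∘ₛ-⊛ Q Q₀ (pow X 3) (D ⊕ pow D 2) n ⟩
    ((pow X 3 ∘ₛ Q) ⊛ ((D ⊕ pow D 2) ∘ₛ Q)) n  ≡⟨ ⊛-cong (∘ₛ-pow-X Q Q₀ 3) substituted n ⟩
    (pow Q 3 ⊛ (X ⊕ pow X 2)) n                ∎
    where
    substituted : (D ⊕ pow D 2) ∘ₛ Q ≈ X ⊕ pow X 2
    substituted i = trans (∘ₛ-⊕ D (pow D 2) Q i)
                          (cong₂ _xor_ (D∘Q≈X i) (trans (∘ₛ-pow Q Q₀ D 2 i) (pow-cong D∘Q≈X 2 i)))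

  -- Multiplying by Q: X⁴Q = (X + X²)Q⁴.
  X⁴Q≈[X+X²]Q⁴ : pow X 4 ⊛ Q ≈ (X ⊛ pow Q 4) ⊕ (pow X 2 ⊛ pow Q 4)
  X⁴Q≈[X+X²]Q⁴ n = begin
    (pow X 4 ⊛ Q) n            ≡⟨ ⊛-congˡ Q X⁴≈Q³[X+X²] n ⟩
    ((pow Q 3 ⊛ B) ⊛ Q) n      ≡⟨ ⊛-assoc (pow Q 3) B Q n ⟩
    (pow Q 3 ⊛ (B ⊛ Q)) n      ≡⟨ ⊛-congʳ (pow Q 3) (⊛-comm B Q) n ⟩
    (pow Q 3 ⊛ (Q ⊛ B)) n      ≡⟨ sym (⊛-assoc (pow Q 3) Q B n) ⟩
    ((pow Q 3 ⊛ Q) ⊛ B) n      ≡⟨ ⊛-congˡ B (⊛-comm (pow Q 3) Q) n ⟩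
    (pow Q 4 ⊛ B) n            ≡⟨ ⊛-comm (pow Q 4) B n ⟩
    (B ⊛ pow Q 4) n            ≡⟨ ⊛-distribʳ (pow Q 4) X (pow X 2) n ⟩
    ((X ⊛ pow Q 4) ⊕ (pow X 2 ⊛ pow Q 4)) n  ∎
    where
    B : Series
    B = X ⊕ pow X 2

  -- The coefficient of X^{n+4}.
  Q-recurrence : ∀ n → Q n ≡ pow Q 4 (3 + n) xor pow Q 4 (2 + n)
  Q-recurrence n = begin
    Q n                                              ≡⟨ sym (Xᵏ-shift 4 Q n) ⟩
    (pow X 4 ⊛ Q) (4 + n)                            ≡⟨ X⁴Q≈[X+X²]Q⁴ (4 + n) ⟩
    (X ⊛ pow Q 4) (4 + n) xor (pow X 2 ⊛ pow Q 4) (4 + n)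
      ≡⟨ cong₂ _xor_ (X-shift (pow Q 4) (3 + n)) (Xᵏ-shift 2 (pow Q 4) (2 + n)) ⟩
    pow Q 4 (3 + n) xor pow Q 4 (2 + n)              ∎

  -- q₁ = 1, because d₁ = b₀ = 1 and D has no constant term.
  Q-1 : Q 1 ≡ true
  Q-1 = trans (sym (⊛-identityʳ Q 1)) (D∘Q≈X 1)

  Q-4t+1 : ∀ t → Q (1 + t * 4) ≡ Q (suc t)
  Q-4t+1 t = trans (Q-recurrence (1 + t * 4))
    (trans (cong₂ _xor_ (pow-4-multiple Q (suc t)) (pow-4-off Q 3 t (s≤s z≤n) ≤-refl)) (xor-identityʳ (Q (suc t))))

  Q-4t+2 : ∀ t → Q (2 + t * 4) ≡ Q (suc t)
  Q-4t+2 t = trans (Q-recurrence (2 + t * 4))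
    (cong₂ _xor_ (pow-4-off Q 1 (suc t) (s≤s z≤n) (s≤s (s≤s z≤n))) (pow-4-multiple Q (suc t)))

  Q-4t+3 : ∀ t → Q (3 + t * 4) ≡ false
  Q-4t+3 t = trans (Q-recurrence (3 + t * 4))
    (cong₂ _xor_ (pow-4-off Q 2 (suc t) (s≤s z≤n) (s≤s (s≤s (s≤s z≤n))))
                 (pow-4-off Q 1 (suc t) (s≤s z≤n) (s≤s (s≤s z≤n))))

  Q-4t+4 : ∀ t → Q (suc t * 4) ≡ false
  Q-4t+4 t = trans (Q-recurrence (suc t * 4))
    (cong₂ _xor_ (pow-4-off Q 3 (suc t) (s≤s z≤n) ≤-refl) (pow-4-off Q 2 (suc t) (s≤s z≤n) (s≤s (s≤s (s≤s z≤n)))))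

  support : ∀ m → (Q (suc m) ≡ true) ⇔ SumOfDistinctPowersOf4 m
  support = <-rec _ (λ m ih → by-digit m (mod4 m) ih)
    where
    Claim : ℕ → Set
    Claim m = (Q (suc m) ≡ true) ⇔ SumOfDistinctPowersOf4 m
    never : ∀ {m} → Q (suc m) ≡ false → ¬ SumOfDistinctPowersOf4 m → Claim m
    never Q≡false impossible = mk⇔ (λ Q≡true → ⊥-elim (false≢true (trans (sym Q≡false) Q≡true)))
                                   (λ sp → ⊥-elim (impossible sp))
    -- Digits 0 and 1 reduce to the quotient t by the recurrences for Q and SP.
    by-digit : ∀ m → Mod4 m → (∀ {k} → k < m → Claim k) → Claim m
    by-digit _ (rem0 zero)    _  = mk⇔ (λ _ → SP-zero) (λ _ → Q-1)
    by-digit _ (rem0 (suc t)) ih =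
      mk⇔ (λ q → SP-×4 (suc t) (to (ih t+1<4t+4) (trans (sym (Q-4t+1 (suc t))) q)))
          (λ sp → trans (Q-4t+1 (suc t)) (from (ih t+1<4t+4) (proj₂ (SP-digit 0 (suc t) (s≤s z≤n) sp))))
      where
      t+1<4t+4 : suc t < suc t * 4
      t+1<4t+4 = s≤s (s≤s (≤-trans (m≤m*n t 4) (m≤n+m (t * 4) 2)))
    by-digit _ (rem1 t) ih =
      mk⇔ (λ q → SP-×4+1 t (to (ih t<4t+1) (trans (sym (Q-4t+2 t)) q)))
          (λ sp → trans (Q-4t+2 t) (from (ih t<4t+1) (proj₂ (SP-digit 1 t (s≤s (s≤s z≤n)) sp))))
      where
      t<4t+1 : t < 1 + t * 4
      t<4t+1 = s≤s (m≤m*n t 4)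
    by-digit _ (rem2 t) _ =
      never (Q-4t+3 t) (λ sp → <⇒≱ (s≤s (s≤s z≤n)) (proj₁ (SP-digit 2 t (s≤s (s≤s (s≤s z≤n))) sp)))
    by-digit _ (rem3 t) _ = never (Q-4t+4 t) (λ sp → <⇒≱ (s≤s (s≤s z≤n)) (proj₁ (SP-digit 3 t ≤-refl sp)))

-- 8. Strictly increasing enumerations are unique

monotone : ∀ v → StrictlyIncreasing v → ∀ {i j} → i ≤ j → v i ≤ v j
monotone v v↑ {i} {j} i≤j with i ≟ j
... | yes refl = ≤-refl
... | no  i≢j  = <⇒≤ (v↑ i j (≤∧≢⇒< i≤j i≢j))

enumeration-bound : ∀ u v → StrictlyIncreasing u → StrictlyIncreasing v → (∀ n → ∃ λ j → v j ≡ u n) →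
  ∀ n → (∀ {i} → i < n → u i ≡ v i) → v n ≤ u n
enumeration-bound u v u↑ v↑ u⊆v n agree with u⊆v n
... | j , vj≡un with j <? n
...   | yes j<n = ⊥-elim (<-irrefl (trans (agree j<n) vj≡un) (u↑ j n j<n))
...   | no  j≮n = subst (v n ≤_) vj≡un (monotone v v↑ (≮⇒≥ j≮n))

enumeration-unique : ∀ u v → StrictlyIncreasing u → StrictlyIncreasing v →
  (∀ n → ∃ λ j → v j ≡ u n) → (∀ n → ∃ λ j → u j ≡ v n) → ∀ n → u n ≡ v n
enumeration-unique u v u↑ v↑ u⊆v v⊆u = <-rec _ λ n agree →
  ≤-antisym (enumeration-bound v u v↑ u↑ v⊆u n (λ i<n → sym (agree i<n)))
            (enumeration-bound u v u↑ v↑ u⊆v n agree)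

mainTheorem8 : (Q : Series) → Q 0 ≡ false → (∀ n → (D ∘ₛ Q) n ≡ X n) → (∀ n → (Q ∘ₛ D) n ≡ X n)
    → (u : ℕ → ℕ) → StrictlyIncreasing u → (∀ m → (Q m ≡ true) ⇔ (∃ λ n → u n ≡ m))
    → (mdb : ℕ → ℕ) → StrictlyIncreasing mdb → (∀ m → SumOfDistinctPowersOf4 m ⇔ (∃ λ n → mdb n ≡ m))
    → ∀ n → u n ≡ mdb n + 1
mainTheorem8 Q Q₀ D∘Q≈X _ u u↑ u-enumerates mdb mdb↑ mdb-enumerates n =
  trans (enumeration-unique u (suc ∘ mdb) u↑ mdb+1↑ u⊆mdb+1 mdb+1⊆u n) (+-comm 1 (mdb n))
  where
  open Inverse Q Q₀ D∘Q≈X using (support)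
  mdb+1↑ : StrictlyIncreasing (suc ∘ mdb)
  mdb+1↑ i j i<j = s≤s (mdb↑ i j i<j)
  -- Every value of u is m + 1 with q_{m+1} = 1 (q₀ = 0), so m is a value of mdb.
  u⊆mdb+1 : ∀ n → ∃ λ j → suc (mdb j) ≡ u n
  u⊆mdb+1 n with u n | from (u-enumerates (u n)) (n , refl)
  ... | zero  | Q0≡true = ⊥-elim (false≢true (trans (sym Q₀) Q0≡true))
  ... | suc m | Qm+1≡true = let (j , mdbj≡m) = to (mdb-enumerates m) (to (support m) Qm+1≡true) in j , cong suc mdbj≡m
  mdb+1⊆u : ∀ n → ∃ λ j → u j ≡ suc (mdb n)
  mdb+1⊆u n = to (u-enumerates (suc (mdb n))) (from (support (mdb n)) (from (mdb-enumerates (mdb n)) (n , refl)))
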